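{- $[\mathbf{Txt}\mathbf{Td}\mathbf{CInd}\mathbf{Ex}_C]_{\mathbf{REC}} = [\mathbf{Txt}\mathbf{Td}\mathbf{Ex}_C]_{\mathbf{REC}}$.
   Context: Fix an acceptable numbering $(\varphi_e)_{e\in\mathbb{N}}$ of all partial computable functions. A number $e$ is a $C$-index if $\varphi_e$ is total with values in $\{0,1\}$; then $C_e=\{x:\varphi_e(x)=1\}$. $\mathbf{REC}$ is the collection of recursive subsets of $\mathbb{N}$; $\mathcal{P}$ denotes the partial computable functions. Fix a pause symbol $\#$. A text is a total function $T:\mathbb{N}\to\mathbb{N}\cup\{\#\}$, $\mathrm{content}(T)=\mathrm{range}(T)\setminus\{\#\}$, $T$ is a text for $L$ if $\mathrm{content}(T)=L$. A learner is some $h\in\mathcal{P}$, which may output a special symbol "?" meaning "no new hypothesis". Transductive hypothesis sequence: $\mathbf{Td}(h,T)(0)=?$, and for $i>0$, $\mathbf{Td}(h,T)(i)=\mathbf{Td}(h,T)(i-1)$ if $h(T(i-1))=?$, else $h(T(i-1))$. Restrictions on hypothesis sequence $p$ and text $T$: $\mathbf{Ex}_C$: there is $n_0$ with $p(n)=p(n_0)$ for all $n\ge n_0$ and $p(n_0)$ a $C$-index with $C_{p(n_0)}=\mathrm{content}(T)$; $\mathbf{CInd}$: for all $i$, $p(i)$ is a $C$-index. Juxtaposition means conjunction. $h$ $\mathbf{Txt}\beta\delta$-learns $L$ iff $\delta(\beta(h,T),T)$ holds for every text $T$ for $L$; $[\mathbf{Txt}\beta\delta]_{\mathbf{REC}}$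 is the set of all classes $\mathcal{L}\subseteq\mathbf{REC}$ for which some $h\in\mathcal{P}$ learns every $L\in\mathcal{L}$. -}

module Defs where

open import Level using (0ℓ)
open import Data.Nat using (ℕ; zero; suc; _+_; _*_; _≤_)
open import Data.Nat.DivMod using (_/_)
open import Data.List using (List; []; _∷_)
open import Data.Maybe using (Maybe; just; nothing)
open import Data.Product using (Σ; ∃; _×_; _,_)
open import Relation.Unary using (Pred)
open import Relation.Binary.PropositionalEquality using (_≡_)
open import Function.Bundles using (_⇔_)

-- A concrete model of partial computable functions: Kleene μ-recursive
-- codes (untyped; arity mismatches simply yield undefinedness / some
-- partial recursive function), a big-step evaluation relation, and a
-- standard injective Gödel numbering with a decidable image.

data Code : Set where
  cz   : Code
  cs   : Code
  cp   : ℕ → Code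
  cc   : Code → List Code → Code
  cr   : Code → Code → Code
  cm   : Code → Code

_‼_ : List ℕ → ℕ → Maybe ℕ
[]       ‼ _       = nothing
(x ∷ xs) ‼ zero    = just x
(x ∷ xs) ‼ suc i   = xs ‼ i

mutual
  data Ev : Code → List ℕ → ℕ → Set where
    ez  : ∀ {xs} → Ev cz xs 0
    es  : ∀ {x xs} → Ev cs (x ∷ xs) (suc x)
    ep  : ∀ {i xs y} → xs ‼ i ≡ just y → Ev (cp i) xs y
    ec  : ∀ {f gs xs ys y} → EvL gs xs ys → Ev f ys y → Ev (cc f gs) xs y
    er0 : ∀ {f g xs y} → Ev f xs y → Ev (cr f g) (0 ∷ xs) y
    erS : ∀ {f g n xs z y} → Ev (cr f g) (n ∷ xs) z → Ev g (n ∷ z ∷ xs) y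
          → Ev (cr f g) (suc n ∷ xs) y
    em  : ∀ {f xs y} → Mu f xs 0 y → Ev (cm f) xs y

  data EvL : List Code → List ℕ → List ℕ → Set where
    []  : ∀ {xs} → EvL [] xs []
    _∷_ : ∀ {g gs xs y ys} → Ev g xs y → EvL gs xs ys → EvL (g ∷ gs) xs (y ∷ ys)

  data Mu (f : Code) (xs : List ℕ) : ℕ → ℕ → Set where
    found : ∀ {k} → Ev f (k ∷ xs) 0 → Mu f xs k k
    next  : ∀ {k v y} → Ev f (k ∷ xs) (suc v) → Mu f xs (suc k) y → Mu f xs k y

⟪_,_⟫ : ℕ → ℕ → ℕ
⟪ a , b ⟫ = ((a + b) * suc (a + b)) / 2 + b

mutual
  encode : Code → ℕ
  encode cz         = 0
  encode cs         = 1
  encode (cp i)     = 6 * i + 2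
  encode (cc f gs)  = 6 * ⟪ encode f , encodeL gs ⟫ + 3
  encode (cr f g)   = 6 * ⟪ encode f , encode g ⟫ + 4
  encode (cm f)     = 6 * encode f + 5

  encodeL : List Code → ℕ
  encodeL []       = 0
  encodeL (g ∷ gs) = suc ⟪ encode g , encodeL gs ⟫

-- The fixed acceptable numbering: φ e x ≃ y.  Numbers outside the image
-- of encode denote the everywhere undefined function.
φ : ℕ → ℕ → ℕ → Set
φ e x y = Σ Code λ c → encode c ≡ e × Ev c (x ∷ []) y

CIndex : ℕ → Set
CIndex e = ∀ x → Σ ℕ λ y → φ e x y × y ≤ 1

C : ℕ → Pred ℕ 0ℓ
C e x = φ e x 1

Language : Set₁
Language = Pred ℕ 0ℓ

Class : Set₁
Class = Pred Language 0ℓ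

_≐_ : Language → Language → Set
L ≐ K = ∀ x → L x ⇔ K x

REC : Class
REC L = Σ ℕ λ e → CIndex e × (C e ≐ L)

_⊆REC : Class → Set₁
𝓛 ⊆REC = ∀ L → 𝓛 L → REC L

-- Texts: nothing = pause symbol #

Text : Set
Text = ℕ → Maybe ℕ

content : Text → Language
content T x = ∃ λ i → T i ≡ just x

IsTextFor : Text → Language → Set
IsTextFor T L = content T ≐ L

-- Learners are indices h of partial computable functions.  Input coding:
-- # ↦ 0, n ↦ n+1.  Output coding: 0 ↦ ?, e+1 ↦ hypothesis e.
codeIn : Maybe ℕ → ℕ
codeIn nothing  = 0
codeIn (just n) = suc n

-- Hypothesis sequences p : ℕ → ℕ ∪ {?}, with nothing = ?.
-- Td h T i p : Td(h,T)(i) is defined and equals p.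
data Td (h : ℕ) (T : Text) : ℕ → Maybe ℕ → Set where
  td0    : Td h T 0 nothing
  tdKeep : ∀ {i p} → Td h T i p → φ h (codeIn (T i)) 0 → Td h T (suc i) p
  tdNew  : ∀ {i p e} → Td h T i p → φ h (codeIn (T i)) (suc e)
           → Td h T (suc i) (just e)

TdExC : ℕ → Text → Set
TdExC h T = Σ ℕ λ n₀ → Σ ℕ λ e →
  (∀ n → n₀ Data.Nat.≤ n → Td h T n (just e)) × CIndex e × (C e ≐ content T)

TdCInd : ℕ → Text → Set
TdCInd h T = ∀ i e → Td h T i (just e) → CIndex e

TxtTdCIndExC-learns : ℕ → Class → Set₁
TxtTdCIndExC-learns h 𝓛 = ∀ L → 𝓛 L → ∀ T → IsTextFor T L → TdCInd h T × TdExC h T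

TxtTdExC-learns : ℕ → Class → Set₁
TxtTdExC-learns h 𝓛 = ∀ L → 𝓛 L → ∀ T → IsTextFor T L → TdExC h T

In-TxtTdCIndExC-REC : Class → Set₁
In-TxtTdCIndExC-REC 𝓛 = 𝓛 ⊆REC × Σ ℕ λ h → TxtTdCIndExC-learns h 𝓛

In-TxtTdExC-REC : Class → Set₁
In-TxtTdExC-REC 𝓛 = 𝓛 ⊆REC × Σ ℕ λ h → TxtTdExC-learns h 𝓛

{-# OPTIONS --safe #-}
-- Txt Td CInd Ex_C trivially implies Txt Td Ex_C.  Conversely, a transductive
-- learner's output depends only on the current datum, so if h outputs e on the
-- datum T j of a text T for L, it outputs e again whenever T j recurs.  Feeding
-- h the text for L that alternates T with T j, it outputs e infinitely often,
-- so its limit hypothesis, a C-index, is e.  This needs determinism of φ, and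
-- hence injectivity of the Gödel numbering.
module Submission where

open import Defs
open import Function.Base using (_∘_)
open import Function.Bundles using (_⇔_; mk⇔; Equivalence)
open import Data.Nat
open import Data.Nat.Properties
open import Data.Nat.DivMod using (_/_; _%_; m*n/n≡m; [m+kn]%n≡m%n; m<n⇒m%n≡m)
open import Data.List using ([]; _∷_)
open import Data.Maybe using (Maybe; just)
open import Data.Maybe.Properties using (just-injective)
open import Data.Product using (Σ; _×_; _,_; proj₂)
open import Data.Sum using (_⊎_; inj₁; inj₂)
open import Data.Empty using (⊥-elim)
open import Relation.Binary.PropositionalEquality
open import Relation.Binary.Definitions using (tri<; tri≈; tri>)
open import Data.Nat.Solver using (module +-*-Solver)

mutual
  Ev-functional : ∀ {c xs y y′} → Ev c xs y → Ev c xs y′ → y ≡ y′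
  Ev-functional ez         ez           = refl
  Ev-functional es         es           = refl
  Ev-functional (ep p)     (ep q)       = just-injective (trans (sym p) q)
  Ev-functional (ec gs f)  (ec gs′ f′)  with refl ← EvL-functional gs gs′ = Ev-functional f f′
  Ev-functional (er0 f)    (er0 f′)     = Ev-functional f f′
  Ev-functional (erS r g)  (erS r′ g′)  with refl ← Ev-functional r r′ = Ev-functional g g′
  Ev-functional (em m)     (em m′)      = Mu-functional m m′

  EvL-functional : ∀ {gs xs ys ys′} → EvL gs xs ys → EvL gs xs ys′ → ys ≡ ys′
  EvL-functional []       []         = refl
  EvL-functional (g ∷ gs) (g′ ∷ gs′) = cong₂ _∷_ (Ev-functional g g′) (EvL-functional gs gs′)

  Mu-functional : ∀ {f xs k y y′} → Mu f xs k y → Mu f xs k y′ → y ≡ y′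
  Mu-functional (found _)  (found _)   = refl
  Mu-functional (found z)  (next s _)  with () ← Ev-functional z s
  Mu-functional (next s _) (found z)   with () ← Ev-functional z s
  Mu-functional (next _ m) (next _ m′) = Mu-functional m m′

*+-remainder : ∀ n q {r} .{{_ : NonZero n}} → r < n → (n * q + r) % n ≡ r
*+-remainder n q {r} r<n = begin
  (n * q + r) % n  ≡⟨ cong (_% n) (trans (+-comm (n * q) r) (cong (r +_) (*-comm n q))) ⟩
  (r + q * n) % n  ≡⟨ [m+kn]%n≡m%n r q n ⟩
  r % n            ≡⟨ m<n⇒m%n≡m r<n ⟩
  r                ∎
  where open ≡-Reasoning

*+-injective : ∀ n {q q′ r r′} .{{_ : NonZero n}} → r < n → r′ < n →
               n * q + r ≡ n * q′ + r′ → q ≡ q′ × r ≡ r′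
*+-injective n {q} {q′} {r} {r′} r<n r′<n eq = q≡q′ , r≡r′
  where
  r≡r′ : r ≡ r′
  r≡r′ = trans (sym (*+-remainder n q r<n)) (trans (cong (_% n) eq) (*+-remainder n q′ r′<n))
  q≡q′ : q ≡ q′
  q≡q′ = *-cancelˡ-≡ q q′ n (+-cancelʳ-≡ r _ _ (trans eq (cong (n * q′ +_) (sym r≡r′))))

triangle : ℕ → ℕ
triangle zero    = 0
triangle (suc n) = suc n + triangle n

n*[1+n]≡triangle*2 : ∀ n → n * suc n ≡ triangle n * 2
n*[1+n]≡triangle*2 zero    = refl
n*[1+n]≡triangle*2 (suc n) = begin
  suc n * suc (suc n)         ≡⟨ solve 1 (λ n → (con 1 :+ n) :* (con 2 :+ n)
                                              := (con 1 :+ n) :* con 2 :+ n :* (con 1 :+ n)) refl n ⟩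
  suc n * 2 + n * suc n       ≡⟨ cong (suc n * 2 +_) (n*[1+n]≡triangle*2 n) ⟩
  suc n * 2 + triangle n * 2  ≡⟨ *-distribʳ-+ 2 (suc n) (triangle n) ⟨
  triangle (suc n) * 2        ∎
  where open ≡-Reasoning
        open +-*-Solver

triangle-mono-≤ : ∀ {m n} → m ≤ n → triangle m ≤ triangle n
triangle-mono-≤ z≤n       = z≤n
triangle-mono-≤ (s≤s m≤n) = +-mono-≤ (s≤s m≤n) (triangle-mono-≤ m≤n)

pair≡triangle+ : ∀ a b → ⟪ a , b ⟫ ≡ triangle (a + b) + b
pair≡triangle+ a b = cong (_+ b) (trans (cong (_/ 2) (n*[1+n]≡triangle*2 (a + b))) (m*n/n≡m _ 2))

-- The pairs on one anti-diagonal a + b = s fill the interval [triangle s, triangle (suc s)).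
triangle+-mono-< : ∀ a b a′ b′ → a + b < a′ + b′ → triangle (a + b) + b < triangle (a′ + b′) + b′
triangle+-mono-< a b a′ b′ s<s′ = begin-strict
  triangle (a + b) + b        ≤⟨ +-monoʳ-≤ (triangle (a + b)) (m≤n+m b a) ⟩
  triangle (a + b) + (a + b)  ≡⟨ +-comm (triangle (a + b)) (a + b) ⟩
  (a + b) + triangle (a + b)  <⟨ n<1+n _ ⟩
  triangle (suc (a + b))      ≤⟨ triangle-mono-≤ s<s′ ⟩
  triangle (a′ + b′)          ≤⟨ m≤m+n _ b′ ⟩
  triangle (a′ + b′) + b′     ∎
  where open ≤-Reasoning

triangle+-injective : ∀ {a b a′ b′} → triangle (a + b) + b ≡ triangle (a′ + b′) + b′ → a ≡ a′ × b ≡ b′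
triangle+-injective {a} {b} {a′} {b′} eq with <-cmp (a + b) (a′ + b′)
... | tri< s<s′ _ _ = ⊥-elim (<⇒≢ (triangle+-mono-< a b a′ b′ s<s′) eq)
... | tri> _ _ s>s′ = ⊥-elim (<⇒≢ (triangle+-mono-< a′ b′ a b s>s′) (sym eq))
... | tri≈ _ s≡s′ _ = a≡a′ , b≡b′
  where
  b≡b′ : b ≡ b′
  b≡b′ = +-cancelˡ-≡ (triangle (a + b)) b b′ (trans eq (cong (λ s → triangle s + b′) (sym s≡s′)))
  a≡a′ : a ≡ a′
  a≡a′ = +-cancelʳ-≡ b a a′ (trans s≡s′ (cong (a′ +_) (sym b≡b′)))

pair-injective : ∀ {a b a′ b′} → ⟪ a , b ⟫ ≡ ⟪ a′ , b′ ⟫ → a ≡ a′ × b ≡ b′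
pair-injective {a} {b} {a′} {b′} eq =
  triangle+-injective (trans (sym (pair≡triangle+ a b)) (trans eq (pair≡triangle+ a′ b′)))

tag payload : Code → ℕ
tag cz       = 0
tag cs       = 1
tag (cp _)   = 2
tag (cc _ _) = 3
tag (cr _ _) = 4
tag (cm _)   = 5
payload cz        = 0
payload cs        = 0
payload (cp i)    = i
payload (cc f gs) = ⟪ encode f , encodeL gs ⟫
payload (cr f g)  = ⟪ encode f , encode g ⟫
payload (cm f)    = encode f

tag<6 : ∀ c → tag c < 6
tag<6 cz       = s≤s z≤n
tag<6 cs       = s≤s (s≤s z≤n)
tag<6 (cp _)   = s≤s (s≤s (s≤s z≤n))
tag<6 (cc _ _) = s≤s (s≤s (s≤s (s≤s z≤n)))
tag<6 (cr _ _) = s≤s (s≤s (s≤s (s≤s (s≤s z≤n))))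
tag<6 (cm _)   = ≤-refl

encode≡6*payload+tag : ∀ c → encode c ≡ 6 * payload c + tag c
encode≡6*payload+tag cz       = refl
encode≡6*payload+tag cs       = refl
encode≡6*payload+tag (cp _)   = refl
encode≡6*payload+tag (cc _ _) = refl
encode≡6*payload+tag (cr _ _) = refl
encode≡6*payload+tag (cm _)   = refl

mutual
  encode-injective : ∀ c c′ → encode c ≡ encode c′ → c ≡ c′
  encode-injective c c′ eq =
    let payload≡ , tag≡ = *+-injective 6 (tag<6 c) (tag<6 c′)
          (trans (sym (encode≡6*payload+tag c)) (trans eq (encode≡6*payload+tag c′)))
    in same-tag-payload c c′ tag≡ payload≡

  same-tag-payload : ∀ c c′ → tag c ≡ tag c′ → payload c ≡ payload c′ → c ≡ c′
  same-tag-payload cz        cz          _ _ = refl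
  same-tag-payload cs        cs          _ _ = refl
  same-tag-payload (cp _)    (cp _)      _ p = cong cp p
  same-tag-payload (cc f gs) (cc f′ gs′) _ p =
    let f≡ , gs≡ = pair-injective p in cong₂ cc (encode-injective f f′ f≡) (encodeL-injective gs gs′ gs≡)
  same-tag-payload (cr f g)  (cr f′ g′)  _ p =
    let f≡ , g≡ = pair-injective p in cong₂ cr (encode-injective f f′ f≡) (encode-injective g g′ g≡)
  same-tag-payload (cm f)    (cm f′)     _ p = cong cm (encode-injective f f′ p)
  same-tag-payload cz       cs       () _
  same-tag-payload cz       (cp _)   () _
  same-tag-payload cz       (cc _ _) () _
  same-tag-payload cz       (cr _ _) () _
  same-tag-payload cz       (cm _)   () _
  same-tag-payload cs       cz       () _
  same-tag-payload cs       (cp _)   () _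
  same-tag-payload cs       (cc _ _) () _
  same-tag-payload cs       (cr _ _) () _
  same-tag-payload cs       (cm _)   () _
  same-tag-payload (cp _)   cz       () _
  same-tag-payload (cp _)   cs       () _
  same-tag-payload (cp _)   (cc _ _) () _
  same-tag-payload (cp _)   (cr _ _) () _
  same-tag-payload (cp _)   (cm _)   () _
  same-tag-payload (cc _ _) cz       () _
  same-tag-payload (cc _ _) cs       () _
  same-tag-payload (cc _ _) (cp _)   () _
  same-tag-payload (cc _ _) (cr _ _) () _
  same-tag-payload (cc _ _) (cm _)   () _
  same-tag-payload (cr _ _) cz       () _
  same-tag-payload (cr _ _) cs       () _
  same-tag-payload (cr _ _) (cp _)   () _
  same-tag-payload (cr _ _) (cc _ _) () _
  same-tag-payload (cr _ _) (cm _)   () _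
  same-tag-payload (cm _)   cz       () _
  same-tag-payload (cm _)   cs       () _
  same-tag-payload (cm _)   (cp _)   () _
  same-tag-payload (cm _)   (cc _ _) () _
  same-tag-payload (cm _)   (cr _ _) () _

  encodeL-injective : ∀ gs gs′ → encodeL gs ≡ encodeL gs′ → gs ≡ gs′
  encodeL-injective []       []         _  = refl
  encodeL-injective (g ∷ gs) (g′ ∷ gs′) eq =
    let g≡ , gs≡ = pair-injective (suc-injective eq)
    in cong₂ _∷_ (encode-injective g g′ g≡) (encodeL-injective gs gs′ gs≡)

φ-functional : ∀ {e x y y′} → φ e x y → φ e x y′ → y ≡ y′
φ-functional (c , c↦e , ev) (c′ , c′↦e , ev′)
  with refl ← encode-injective c c′ (trans c↦e (sym c′↦e)) = Ev-functional ev ev′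

Td-functional : ∀ {h T i p p′} → Td h T i p → Td h T i p′ → p ≡ p′
Td-functional td0           td0            = refl
Td-functional (tdKeep d _)  (tdKeep d′ _)  = Td-functional d d′
Td-functional (tdKeep _ f)  (tdNew _ f′)   with () ← φ-functional f f′
Td-functional (tdNew _ f)   (tdKeep _ f′)  with () ← φ-functional f f′
Td-functional (tdNew _ f)   (tdNew _ f′)   with refl ← φ-functional f f′ = refl

Td-output : ∀ {h T i e} → Td h T i (just e) → Σ ℕ λ j → φ h (codeIn (T j)) (suc e)
Td-output (tdKeep d _)            = Td-output d
Td-output {i = suc i} (tdNew _ f) = i , f

interleave : Text → Maybe ℕ → Text
interleave T a zero          = T 0
interleave T a (suc zero)    = a
interleave T a (suc (suc n)) = interleave (T ∘ suc) a n

interleave-even : ∀ T a k → interleave T a (2 * k) ≡ T k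
interleave-even T a zero    = refl
interleave-even T a (suc k) rewrite +-suc k (k + 0) = interleave-even (T ∘ suc) a k

interleave-odd : ∀ T a k → interleave T a (suc (2 * k)) ≡ a
interleave-odd T a zero    = refl
interleave-odd T a (suc k) rewrite +-suc k (k + 0) = interleave-odd (T ∘ suc) a k

interleave-cases : ∀ T a n → interleave T a n ≡ a ⊎ Σ ℕ λ k → interleave T a n ≡ T k
interleave-cases T a zero          = inj₂ (0 , refl)
interleave-cases T a (suc zero)    = inj₁ refl
interleave-cases T a (suc (suc n)) with interleave-cases (T ∘ suc) a n
... | inj₁ eq       = inj₁ eq
... | inj₂ (k , eq) = inj₂ (suc k , eq)

interleave-isTextFor : ∀ T j {L} → IsTextFor T L → IsTextFor (interleave T (T j)) L
interleave-isTextFor T j {L} T↦L x = mk⇔ to from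
  where
  to : content (interleave T (T j)) x → L x
  to (n , eq) with interleave-cases T (T j) n
  ... | inj₁ eq′       = Equivalence.to (T↦L x) (j , trans (sym eq′) eq)
  ... | inj₂ (k , eq′) = Equivalence.to (T↦L x) (k , trans (sym eq′) eq)
  from : L x → content (interleave T (T j)) x
  from x∈L = let k , eq = Equivalence.from (T↦L x) x∈L in 2 * k , trans (interleave-even T (T j) k) eq

TdExC⇒TdCInd : ∀ h L → (∀ T → IsTextFor T L → TdExC h T) → ∀ T → IsTextFor T L → TdCInd h T
TdExC⇒TdCInd h L learns T T↦L i e d
  with j , outputs-e ← Td-output d
  with n₀ , e′ , converges , e′-CIndex , _ ← learns (interleave T (T j)) (interleave-isTextFor T j T↦L)
  = subst CIndex (sym e≡e′) e′-CIndex
  where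
  n₀≤2n₀ : n₀ ≤ 2 * n₀
  n₀≤2n₀ = m≤m+n n₀ (n₀ + 0)
  before : Td h (interleave T (T j)) (suc (2 * n₀)) (just e′)
  before = converges _ (m≤n⇒m≤1+n n₀≤2n₀)
  datum-is-T-j : φ h (codeIn (interleave T (T j) (suc (2 * n₀)))) (suc e)
  datum-is-T-j = subst (λ t → φ h (codeIn t) (suc e)) (sym (interleave-odd T (T j) n₀)) outputs-e
  e≡e′ : e ≡ e′
  e≡e′ = just-injective (Td-functional (tdNew before datum-is-T-j)
                                       (converges _ (m≤n⇒m≤1+n (m≤n⇒m≤1+n n₀≤2n₀))))

theorem9 : ∀ (𝓛 : Class) → In-TxtTdCIndExC-REC 𝓛 ⇔ In-TxtTdExC-REC 𝓛
theorem9 𝓛 = mk⇔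
  (λ (⊆REC , h , learns) → ⊆REC , h , λ L L∈𝓛 T T↦L → proj₂ (learns L L∈𝓛 T T↦L))
  (λ (⊆REC , h , learns) → ⊆REC , h , λ L L∈𝓛 T T↦L →
     TdExC⇒TdCInd h L (learns L L∈𝓛) T T↦L , learns L L∈𝓛 T T↦L)
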